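{- Let $A,B$ be sets and $(\mathcal{K},\delta)$ a $\mathbb{T}_A$-$\mathbb{T}_B$-bimodel with underlying set $K$. Then the function $K\to\mathbf{Top}(A^{\mathbb{N}},B^{\mathbb{N}})$, $k\mapsto\mathsf{tr}^{\check{\mathcal{K}}}(k)$, is the unique map of bimodels $\mathcal{K}\to E_{AB}$; that is, the image of $k\in K$ under the unique bimodel map $\mathcal{K}\to E_{AB}$ is the continuous function $\mathsf{tr}^{\check{\mathcal{K}}}(k)\colon A^{\mathbb{N}}\to B^{\mathbb{N}}$.
   Context: An $A$-ary magma is a set $X$ with $\xi\colon X^A\to X$. $T_A(V)$ is the set of well-founded $A$-ary trees with leaves in $V$ (leaves $v$, nodes $\mathsf{read}(\lambda a.\,t_a)$). A $\mathbb{T}_A$-$\mathbb{T}_B$-bimodel is an $A$-ary magma $\mathcal{K}$ with a magma homomorphism $\delta\colon\mathcal{K}\to B\cdot\mathcal{K}$ into the $B$-fold copower in magmas; maps of bimodels are homomorphisms $f$ with $\delta'f=(B\cdot f)\delta$. The copower $B\cdot(K,\xi)$ may be represented as the set of trees in $T_A(B\times K)$ in which no subtree rooted at an interior node has all leaves labelled by the same element of $B$, with coprojections $x\mapsto$ leaf $(b,x)$ and operation $\upsilon(\lambda a.\,t_a)=(b,\xi(\lambda a.\,x_a))$ if each $t_a$ is a leaf $(b,x_a)$ with a common $b$, else $\mathsf{read}(\lambda a.\,t_a)$. $\check{\mathcal{K}}$ is the set $K$ with $\gamma\colon K\to T_A(B\times K)$ the composite of $\delta$ with this inclusion $B\cdot\mathcal{K}\subseteq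 T_A(B\times K)$. Streams carry the product of discrete topologies, $\partial$ is the shift. For $t\in T_A(V)$, $\langle t\rangle\colon A^{\mathbb{N}}\to V\times A^{\mathbb{N}}$ is given by $\langle v\rangle(\vec a)=(v,\vec a)$, $\langle\mathsf{read}(\lambda a.\,t_a)\rangle(\vec a)=\langle t_{a_0}\rangle(\partial\vec a)$. Writing $\langle\gamma(k)\rangle(\vec a)=(\mathsf{hd}(k,\vec a),\mathsf{next}(k,\vec a),\mathsf{tl}(k,\vec a))$, the trace $\mathsf{tr}^{\check{\mathcal{K}}}(k)\colon A^{\mathbb{N}}\to B^{\mathbb{N}}$ is defined coinductively by $(\mathsf{tr}(k)(\vec a))_0=\mathsf{hd}(k,\vec a)$ and $\partial(\mathsf{tr}(k)(\vec a))=\mathsf{tr}(\mathsf{next}(k,\vec a))(\mathsf{tl}(k,\vec a))$. $E_{AB}$ is the bimodel with underlying set $\mathbf{Top}(A^{\mathbb{N}},B^{\mathbb{N}})$ of continuous maps, magma operation $\mathsf{split}(\vec f)(\vec a)=f_{a_0}(\partial\vec a)$, and comultiplication the composite of postcomposition with the homeomorphism $B^{\mathbb{N}}\to B\times B^{\mathbb{N}}$, $\vec b\mapsto(b_0,\partial\vec b)$, and the inverse of the magma isomorphism $B\cdot\mathbf{Top}(A^{\mathbb{N}},B^{\mathbb{N}})\to\mathbf{Top}(A^{\mathbb{N}},B\times B^{\mathbb{N}})$ whose $b$-th component is $f\mapsto(\vec a\mapsto(b,f(\vec a)))$; it is a final bimodel. -}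

module Defs where

open import Data.Nat using (ℕ; zero; suc; _<_; s≤s; z≤n)
open import Data.Product using (Σ; _×_; _,_; proj₁; proj₂)
open import Data.Unit using (⊤)
open import Data.Sum using (_⊎_)
open import Relation.Binary.PropositionalEquality using (_≡_; refl; trans; cong)
open import Relation.Nullary using (¬_)

Stream : Set → Set
Stream X = ℕ → X

∂ : {X : Set} → Stream X → Stream X
∂ s n = s (suc n)

-- Product of discrete topologies: basic opens are cylinders, so
-- continuity unfolds to: every finite prefix of the output depends
-- only on a finite prefix of the input (pointwise, not uniformly).
Agree : {X : Set} → ℕ → Stream X → Stream X → Set
Agree n s s' = ∀ i → i < n → s i ≡ s' i

Continuous : {A B : Set} → (Stream A → Stream B) → Set
Continuous f = ∀ s n → Σ ℕ λ m → ∀ s' → Agree m s s' → Agree n (f s) (f s')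

Top : Set → Set → Set
Top A B = Σ (Stream A → Stream B) Continuous

data Tree (A V : Set) : Set where
  leaf : V → Tree A V
  read : (A → Tree A V) → Tree A V

-- extensional equality of trees (equality of well-founded trees as sets)
data _≈T_ {A V : Set} : Tree A V → Tree A V → Set where
  leaf≈ : ∀ {v w} → v ≡ w → leaf v ≈T leaf w
  read≈ : ∀ {f g} → (∀ a → f a ≈T g a) → read f ≈T read g

eval : {A V : Set} → Tree A V → Stream A → V × Stream A
eval (leaf v)  s = v , s
eval (read ts) s = eval (ts (s 0)) (∂ s)

-- relabelling leaves (b , x) ↦ (b , g x); this is B·g in the tree
-- representation of the copower
mapT : {A B K L : Set} → (K → L) → Tree A (B × K) → Tree A (B × L)
mapT g (leaf (b , x)) = leaf (b , g x)
mapT g (read ts)      = read (λ a → mapT g (ts a))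

-- Copower B·K represented as "reduced" trees in T_A(B × K)

AllLabelled : {A B K : Set} → B → Tree A (B × K) → Set
AllLabelled b (leaf (b' , _)) = b' ≡ b
AllLabelled b (read ts)       = ∀ a → AllLabelled b (ts a)

Reduced : {A B K : Set} → Tree A (B × K) → Set
Reduced (leaf _) = ⊤
Reduced {A} {B} (read ts) =
  (¬ Σ B λ b → AllLabelled b (read ts)) × (∀ a → Reduced (ts a))

-- The graph of the copower operation υ : (A → B·K) → B·K :
-- Upsilon ξ ts t  means  υ ts = t.
Upsilon : {A B K : Set} → ((A → K) → K) → (A → Tree A (B × K)) → Tree A (B × K) → Set
Upsilon {A} {B} {K} ξ ts t =
  (Σ B λ b → Σ (A → K) λ x → (∀ a → ts a ≡ leaf (b , x a)) × (t ≈T leaf (b , ξ x)))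
  ⊎ ((¬ Σ B λ b → Σ (A → K) λ x → ∀ a → ts a ≡ leaf (b , x a)) × (t ≈T read ts))

-- T_A-T_B-bimodels, given as (K, ξ) together with
-- γ = (δ followed by the inclusion B·K ⊆ T_A(B × K))

record Bimodel (A B : Set) : Set₁ where
  field
    K       : Set
    ξ       : (A → K) → K
    γ       : K → Tree A (B × K)
    -- δ lands in B·K
    γ-red   : ∀ k → Reduced (γ k)
    -- δ is a magma homomorphism  (K , ξ) → B·(K , ξ)
    γ-hom   : ∀ (x : A → K) → Upsilon ξ (λ a → γ (x a)) (γ (ξ x))

module _ {A B : Set} (𝒦 : Bimodel A B) where
  open Bimodel 𝒦

  hd : K → Stream A → B
  hd k s = proj₁ (proj₁ (eval (γ k) s))

  next : K → Stream A → K
  next k s = proj₂ (proj₁ (eval (γ k) s))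

  tl : K → Stream A → Stream A
  tl k s = proj₂ (eval (γ k) s)

  tr : K → Stream A → Stream B
  tr k s zero    = hd k s
  tr k s (suc n) = tr (next k s) (tl k s) n

split : {A B : Set} → (A → Stream A → Stream B) → Stream A → Stream B
split f s = f (s 0) (∂ s)

split-cont : {A B : Set} (f : A → Top A B) → Continuous (split (λ a → proj₁ (f a)))
split-cont {A} {B} f s n with proj₂ (f (s 0)) (∂ s) n
... | m , h = suc m , λ s' ag i i<n →
  trans (h (∂ s') (λ j j<m → ag (suc j) (s≤s j<m)) i i<n)
        (cong (λ a → proj₁ (f a) (∂ s') i) (ag 0 (s≤s z≤n)))

splitTop : {A B : Set} → (A → Top A B) → Top A B
splitTop f = split (λ a → proj₁ (f a)) , split-cont f

-- Φ : B·Top(A^ℕ,B^ℕ) → Top(A^ℕ, B × B^ℕ), the magma homomorphism whose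
-- b-th component is f ↦ (a⃗ ↦ (b , f a⃗)) (on the tree representation:
-- leaves are coprojections, interior nodes are the split operation)
Φ : {A B : Set} → Tree A (B × Top A B) → Stream A → B × Stream B
Φ (leaf (b , f)) s = b , proj₁ f s
Φ (read ts)      s = Φ (ts (s 0)) (∂ s)

post : {A B : Set} → Top A B → Stream A → B × Stream B
post f s = proj₁ f s 0 , ∂ (proj₁ f s)

-- δ_E h = t , where δ_E = Φ⁻¹ ∘ post :  t ∈ B·Top and Φ t = post h
DeltaE : {A B : Set} → Top A B → Tree A (B × Top A B) → Set
DeltaE h t = Reduced t ×
  (∀ s → (proj₁ (Φ t s) ≡ proj₁ (post h s)) × (∀ n → proj₂ (Φ t s) n ≡ proj₂ (post h s) n))

-- g : K → Top(A^ℕ,B^ℕ) is a map of bimodels 𝒦 → E_AB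
-- (equality in Top(A^ℕ,B^ℕ) is equality of the underlying functions)
IsBimodelMapToE : {A B : Set} (𝒦 : Bimodel A B) → (Bimodel.K 𝒦 → Top A B) → Set
IsBimodelMapToE {A} {B} 𝒦 g =
  (∀ (x : A → K) s n → proj₁ (g (ξ x)) s n ≡ proj₁ (splitTop (λ a → g (x a))) s n)
  × (∀ k → DeltaE (g k) (mapT g (γ k)))
  where open Bimodel 𝒦

{-# OPTIONS --safe #-}
-- Compatibility with the comultiplication alone pins a map g : K → Top(A^ℕ,B^ℕ) down:
-- it says g k a⃗ has head hd(k,a⃗) and tail g (next(k,a⃗)) (tl(k,a⃗)), so by induction
-- on the output index g is the trace. The trace is continuous since output position
-- n+1 reads only depth(γ k, a⃗) input letters before recursing. It respects ξ because
-- δ is a magma homomorphism: either γ(ξ x) is read(λ a. γ(x a)), which evaluates like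
-- γ(x a₀) on ∂ a⃗, or every γ(x a) is a leaf (b, x' a) and both traces are b followed
-- by tr(ξ x') a⃗ and tr(x' a₀)(∂ a⃗) respectively.
module Submission where

open import Defs
open import Data.Product using (Σ; _×_; _,_; proj₁; proj₂)
open import Relation.Binary.PropositionalEquality using (_≡_; refl; sym; trans; cong)
open import Data.Nat using (ℕ; zero; suc; _+_; s≤s; z≤n)
open import Data.Unit using (tt)
open import Data.Sum using (inj₁; inj₂)

_∷ˢ_ : {X : Set} → X → Stream X → Stream X
(x ∷ˢ xs) zero    = x
(x ∷ˢ xs) (suc n) = xs n

depth : {A V : Set} → Tree A V → Stream A → ℕ
depth (leaf _)  s = 0
depth (read ts) s = suc (depth (ts (s 0)) (∂ s))

eval-agree : {A V : Set} (t : Tree A V) (s s' : Stream A) (m : ℕ) →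
  Agree (depth t s + m) s s' →
  (proj₁ (eval t s) ≡ proj₁ (eval t s')) × Agree m (proj₂ (eval t s)) (proj₂ (eval t s'))
eval-agree (leaf v)  s s' m ag = refl , ag
eval-agree (read ts) s s' m ag with s' 0 | ag 0 (s≤s z≤n)
... | .(s 0) | refl = eval-agree (ts (s 0)) (∂ s) (∂ s') m (λ i i< → ag (suc i) (s≤s i<))

eval-≈T : {A V : Set} {t t' : Tree A V} → t ≈T t' → ∀ s → eval t s ≡ eval t' s
eval-≈T (leaf≈ refl) s = refl
eval-≈T (read≈ h)    s = eval-≈T (h (s 0)) (∂ s)

Φ-mapT : {A B K : Set} (g : K → Top A B) (t : Tree A (B × K)) (s : Stream A) →
  Φ (mapT g t) s ≡ (proj₁ (proj₁ (eval t s)) , proj₁ (g (proj₂ (proj₁ (eval t s)))) (proj₂ (eval t s)))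
Φ-mapT g (leaf _)  s = refl
Φ-mapT g (read ts) s = Φ-mapT g (ts (s 0)) (∂ s)

AllLabelled-mapT⁻ : {A B K L : Set} (g : K → L) (b : B) (t : Tree A (B × K)) →
  AllLabelled b (mapT g t) → AllLabelled b t
AllLabelled-mapT⁻ g b (leaf _)  h   = h
AllLabelled-mapT⁻ g b (read ts) h a = AllLabelled-mapT⁻ g b (ts a) (h a)

Reduced-mapT : {A B K L : Set} (g : K → L) (t : Tree A (B × K)) → Reduced t → Reduced (mapT g t)
Reduced-mapT g (leaf _)  _ = tt
Reduced-mapT g (read ts) (unlabelled , reduced) =
  (λ (b , labelled) → unlabelled (b , λ a → AllLabelled-mapT⁻ g b (ts a) (labelled a)))
  , λ a → Reduced-mapT g (ts a) (reduced a)

module _ {A B : Set} (𝒦 : Bimodel A B) where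
  open Bimodel 𝒦

  tr-continuous : ∀ k → Continuous (tr 𝒦 k)
  tr-continuous k s zero    = 0 , λ _ _ _ ()
  tr-continuous k s (suc n) = depth (γ k) s + m , agree
    where
    m = proj₁ (tr-continuous (next 𝒦 k s) (tl 𝒦 k s) n)

    agree : ∀ s' → Agree (depth (γ k) s + m) s s' → Agree (suc n) (tr 𝒦 k s) (tr 𝒦 k s')
    agree s' ag i i< with eval-agree (γ k) s s' m ag
    agree s' ag zero    _         | same-leaf , _ = cong proj₁ same-leaf
    agree s' ag (suc j) (s≤s j<n) | same-leaf , tails-agree =
      trans (proj₂ (tr-continuous (next 𝒦 k s) (tl 𝒦 k s) n) (tl 𝒦 k s') tails-agree j j<n)
            (cong (λ k' → tr 𝒦 k' (tl 𝒦 k s') j) (cong proj₂ same-leaf))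

  tr-cong : ∀ {k k' s s'} → eval (γ k) s ≡ eval (γ k') s' → ∀ n → tr 𝒦 k s n ≡ tr 𝒦 k' s' n
  tr-cong e zero    = cong (λ p → proj₁ (proj₁ p)) e
  tr-cong e (suc n) = cong (λ p → tr 𝒦 (proj₂ (proj₁ p)) (proj₂ p) n) e

  tr-step : ∀ {k s b k' s'} → eval (γ k) s ≡ ((b , k') , s') →
    ∀ n → tr 𝒦 k s n ≡ (b ∷ˢ tr 𝒦 k' s') n
  tr-step e zero    = cong (λ p → proj₁ (proj₁ p)) e
  tr-step e (suc n) = cong (λ p → tr 𝒦 (proj₂ (proj₁ p)) (proj₂ p) n) e

  tr-ξ : ∀ (x : A → K) s n → tr 𝒦 (ξ x) s n ≡ tr 𝒦 (x (s 0)) (∂ s) n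
  tr-ξ x s n with γ-hom x
  ... | inj₂ (_ , γξ≈read) = tr-cong (eval-≈T γξ≈read s) n
  ... | inj₁ (b , x' , γx≡leaf , γξ≈leaf) =
    trans (tr-step (eval-≈T γξ≈leaf s) n)
      (trans (same-tails n) (sym (tr-step (cong (λ t → eval t (∂ s)) (γx≡leaf (s 0))) n)))
    where
    same-tails : ∀ n → (b ∷ˢ tr 𝒦 (ξ x') s) n ≡ (b ∷ˢ tr 𝒦 (x' (s 0)) (∂ s)) n
    same-tails zero     = refl
    same-tails (suc n') = tr-ξ x' s n'

  trTop : K → Top A B
  trTop k = tr 𝒦 k , tr-continuous k

  tr-δ : ∀ k → DeltaE (trTop k) (mapT trTop (γ k))
  tr-δ k = Reduced-mapT trTop (γ k) (γ-red k)
         , λ s → cong proj₁ (Φ-mapT trTop (γ k) s) , λ n → cong (λ p → proj₂ p n) (Φ-mapT trTop (γ k) s)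

  tr-unique : (g : K → Top A B) → (∀ k → DeltaE (g k) (mapT g (γ k))) →
    ∀ k s n → proj₁ (g k) s n ≡ tr 𝒦 k s n
  tr-unique g g-δ k s zero    = trans (sym (proj₁ (proj₂ (g-δ k) s))) (cong proj₁ (Φ-mapT g (γ k) s))
  tr-unique g g-δ k s (suc n) =
    trans (sym (proj₂ (proj₂ (g-δ k) s) n))
      (trans (cong (λ p → proj₂ p n) (Φ-mapT g (γ k) s))
             (tr-unique g g-δ (next 𝒦 k s) (tl 𝒦 k s) n))

proposition6p5 : (A B : Set) (𝒦 : Bimodel A B) →
    Σ (∀ k → Continuous (tr 𝒦 k)) λ cont →
    IsBimodelMapToE 𝒦 (λ k → tr 𝒦 k , cont k)
    × (∀ (g : Bimodel.K 𝒦 → Top A B) → IsBimodelMapToE 𝒦 g →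
    ∀ k s n → proj₁ (g k) s n ≡ tr 𝒦 k s n)
proposition6p5 A B 𝒦 =
  tr-continuous 𝒦 , (tr-ξ 𝒦 , tr-δ 𝒦) , λ g (_ , g-δ) → tr-unique 𝒦 g g-δ
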